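{- If $G$ is a cycle of order $n\geq 4$, then $mvd(G)=\left\lfloor \frac{n}{2}\right\rfloor$.
   Context: For a vertex-coloring of $G$ (adjacent vertices may share colors), a vertex set is monochromatic if all its vertices have the same color; for distinct $x,y$, an $x$-$y$ vertex cut is a set $D\subseteq V(G)\setminus\{x,y\}$ with $x,y$ in different components of $G-D$. A coloring is an MVD-coloring if every two nonadjacent vertices $x,y$ have a monochromatic $x$-$y$ vertex cut. $mvd(G)$ is the maximum number of colors used by an MVD-coloring of $G$. -}

module Defs where

open import Data.Nat using (ℕ; zero; suc; _≤_)
open import Data.Fin using (Fin; toℕ)
open import Data.Fin.Subset using (Subset; _∈_; _∉_)
open import Data.Product using (Σ; ∃; _×_)
open import Data.Sum using (_⊎_)
open import Relation.Nullary using (¬_)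
open import Relation.Binary.PropositionalEquality using (_≡_; _≢_)

Graph : ℕ → Set₁
Graph n = Fin n → Fin n → Set

Cycle : (n : ℕ) → Graph n
Cycle n i j =
  (suc (toℕ i) ≡ toℕ j) ⊎ (suc (toℕ j) ≡ toℕ i) ⊎
  ((toℕ i ≡ 0 × suc (toℕ j) ≡ n) ⊎ (toℕ j ≡ 0 × suc (toℕ i) ≡ n))

data Conn {n : ℕ} (G : Graph n) (D : Subset n) : Fin n → Fin n → Set where
  here : ∀ {x} → x ∉ D → Conn G D x x
  step : ∀ {x y z} → x ∉ D → G x y → Conn G D y z → Conn G D x z

VertexCut : {n : ℕ} → Graph n → Fin n → Fin n → Subset n → Set
VertexCut G x y D = x ∉ D × y ∉ D × ¬ Conn G D x y

Monochromatic : {n k : ℕ} → (Fin n → Fin k) → Subset n → Set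
Monochromatic c D = ∀ u v → u ∈ D → v ∈ D → c u ≡ c v

UsesAll : {n k : ℕ} → (Fin n → Fin k) → Set
UsesAll {n} {k} c = ∀ (a : Fin k) → ∃ λ (v : Fin n) → c v ≡ a

IsMVDColoring : {n k : ℕ} → Graph n → (Fin n → Fin k) → Set
IsMVDColoring {n} G c =
  ∀ (x y : Fin n) → x ≢ y → ¬ G x y →
    ∃ λ (D : Subset n) → VertexCut G x y D × Monochromatic c D

MVD≡ : {n : ℕ} → Graph n → ℕ → Set
MVD≡ {n} G m =
  (Σ (Fin n → Fin m) λ c → UsesAll c × IsMVDColoring G c) ×
  (∀ (k : ℕ) (c : Fin n → Fin k) → UsesAll c → IsMVDColoring G c → k ≤ m)

{-# OPTIONS --safe #-}
-- In an MVD-colouring of C_n every colour class has at least two vertices: the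
-- neighbours x, y of a vertex v are non-adjacent, a monochromatic x–y cut must
-- contain v, and it cannot be {v} alone because C_n − v is still connected.
-- Hence 2k ≤ n. Conversely, colour vertex i by i mod ⌊n/2⌋: for non-adjacent
-- x < y, some p strictly between them and q = p ± ⌊n/2⌋ outside [x, y] share a
-- colour, and {p, q} separates x from y.
module Submission where

open import Defs
open import Data.Nat using (ℕ; zero; suc; _+_; _∸_; _≤_; _<_; _<?_; _≤?_; z≤n; s≤s; s≤s⁻¹; _%_; NonZero; ⌊_/2⌋)
open import Data.Nat.Properties
open import Data.Nat.DivMod using (m%n<n; [m+n]%n≡m%n; m<n⇒m%n≡m)
open import Data.Fin using (Fin; zero; suc; toℕ; fromℕ; fromℕ<; inject₁; inject≤; splitAt)
open import Data.Fin.Properties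
  using (toℕ-injective; toℕ<n; toℕ-fromℕ; toℕ-fromℕ<; toℕ-inject₁; fromℕ<-cong; toℕ-inject≤; any?; injective⇒≤; +↔⊎)
  renaming (_≟_ to _≟ᶠ_)
open import Data.Fin.Subset using (_∈_; _∉_; _⊆_; ⁅_⁆; _∪_)
open import Data.Fin.Subset.Properties using (_∈?_; x∈⁅x⁆; x∈⁅y⁆⇒x≡y; x≢y⇒x∉⁅y⁆; x∈p∪q⁻; x∈p∪q⁺)
open import Data.Product using (∃; _×_; _,_; proj₁; proj₂)
open import Data.Sum using (_⊎_; inj₁; inj₂; [_,_]′)
open import Data.Empty using (⊥-elim)
open import Function using (_∘_; id)
open import Function.Bundles using (Injection)
open import Function.Properties.Inverse using (↔⇒↣)
open import Relation.Nullary using (¬_; yes; no)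
open import Relation.Nullary.Decidable using (¬?; _×-dec_; decidable-stable)
open import Relation.Binary.PropositionalEquality
open import Relation.Binary.Definitions using (tri<; tri≈; tri>)

module _ {n : ℕ} {G : Graph n} where

  Conn-source∉ : ∀ {D x y} → Conn G D x y → x ∉ D
  Conn-source∉ (here x∉D)     = x∉D
  Conn-source∉ (step x∉D _ _) = x∉D

  Conn-mono : ∀ {D E x y} → D ⊆ E → Conn G E x y → Conn G D x y
  Conn-mono D⊆E (here x∉E)        = here (x∉E ∘ D⊆E)
  Conn-mono D⊆E (step x∉E xy walk) = step (x∉E ∘ D⊆E) xy (Conn-mono D⊆E walk)

  Conn-preserves : ∀ {D} (S : Fin n → Set) → (∀ {u v} → v ∉ D → G u v → S u → S v) →
                   ∀ {x y} → Conn G D x y → S x → S y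
  Conn-preserves S closed (here _)         Sx = Sx
  Conn-preserves S closed (step _ xy walk) Sx =
    Conn-preserves S closed walk (closed (Conn-source∉ walk) xy Sx)

  Conn-++ : ∀ {D x y z} → Conn G D x y → Conn G D y z → Conn G D x z
  Conn-++ (here _)          yz = yz
  Conn-++ (step x∉D xy walk) yz = step x∉D xy (Conn-++ walk yz)

  module _ (G-sym : ∀ {u v} → G u v → G v u) where

    Conn-reverse : ∀ {D x y} → Conn G D x y → Conn G D y x
    Conn-reverse (here x∉D)          = here x∉D
    Conn-reverse (step x∉D xy walk) =
      Conn-++ (Conn-reverse walk) (step (Conn-source∉ walk) (G-sym xy) (here x∉D))

    VertexCut-sym : ∀ {D x y} → VertexCut G x y D → VertexCut G y x D
    VertexCut-sym (x∉D , y∉D , ¬xy) = y∉D , x∉D , ¬xy ∘ Conn-reverse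

record Detour {n : ℕ} (G : Graph n) (v : Fin n) : Set where
  field
    {x y}  : Fin n
    x≢y    : x ≢ y
    x≁y    : ¬ G x y
    x∼v    : G x v
    v∼y    : G v y
    bypass : Conn G ⁅ v ⁆ x y

module _ {n k : ℕ} {G : Graph n} {c : Fin n → Fin k} where

  Detour⇒partner : IsMVDColoring G c → ∀ {v} → Detour G v → ∃ λ w → w ≢ v × c w ≡ c v
  Detour⇒partner mvd {v} d = partner (mvd x y x≢y x≁y)
    where
    open Detour d
    partner : (∃ λ D → VertexCut G x y D × Monochromatic c D) → ∃ λ w → w ≢ v × c w ≡ c v
    partner (D , (x∉D , y∉D , ¬xy) , mono) with v ∈? D | any? (λ w → (w ∈? D) ×-dec ¬? (w ≟ᶠ v))
    ... | no v∉D  | _                   = ⊥-elim (¬xy (step x∉D x∼v (step v∉D v∼y (here y∉D))))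
    ... | yes v∈D | yes (w , w∈D , w≢v) = w , w≢v , mono w v w∈D v∈D
    ... | yes _   | no ¬partner         = ⊥-elim (¬xy (Conn-mono D⊆⁅v⁆ bypass))
      where
      D⊆⁅v⁆ : D ⊆ ⁅ v ⁆
      D⊆⁅v⁆ {w} w∈D = subst (_∈ ⁅ v ⁆)
        (sym (decidable-stable (w ≟ᶠ v) (λ w≢v → ¬partner (w , w∈D , w≢v)))) (x∈⁅x⁆ v)

partners⇒2k≤n : ∀ {n k} (c : Fin n → Fin k) → UsesAll c →
                (∀ v → ∃ λ w → w ≢ v × c w ≡ c v) → k + k ≤ n
partners⇒2k≤n {n} {k} c surj partner =
  injective⇒≤ {f = h ∘ splitAt k} (Injection.injective (↔⇒↣ +↔⊎) ∘ h-injective _ _)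
  where
  rep : Fin k → Fin n
  rep a = proj₁ (surj a)
  h : Fin k ⊎ Fin k → Fin n
  h (inj₁ a) = rep a
  h (inj₂ a) = proj₁ (partner (rep a))
  colour-h : ∀ s → c (h s) ≡ [ id , id ]′ s
  colour-h (inj₁ a) = proj₂ (surj a)
  colour-h (inj₂ a) = trans (proj₂ (proj₂ (partner (rep a)))) (proj₂ (surj a))
  same-colour : ∀ s t → h s ≡ h t → [ id , id ]′ s ≡ [ id , id ]′ t
  same-colour s t eq = trans (sym (colour-h s)) (trans (cong c eq) (colour-h t))
  h-injective : ∀ s t → h s ≡ h t → s ≡ t
  h-injective (inj₁ a) (inj₁ b) eq = cong inj₁ (same-colour (inj₁ a) (inj₁ b) eq)
  h-injective (inj₂ a) (inj₂ b) eq = cong inj₂ (same-colour (inj₂ a) (inj₂ b) eq)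
  h-injective (inj₁ a) (inj₂ b) eq with same-colour (inj₁ a) (inj₂ b) eq
  ... | refl = ⊥-elim (proj₁ (proj₂ (partner (rep a))) (sym eq))
  h-injective (inj₂ a) (inj₁ b) eq with same-colour (inj₂ a) (inj₁ b) eq
  ... | refl = ⊥-elim (proj₁ (proj₂ (partner (rep a))) eq)

2k≤n⇒k≤⌊n/2⌋ : ∀ {k n} → k + k ≤ n → k ≤ ⌊ n /2⌋
2k≤n⇒k≤⌊n/2⌋ {k} 2k≤n = subst (_≤ _) (sym (n≡⌊n+n/2⌋ k)) (⌊n/2⌋-mono 2k≤n)

-- Cycle n u v is definitionally Adjacent n (toℕ u) (toℕ v).
Adjacent : ℕ → ℕ → ℕ → Set
Adjacent n i j = suc i ≡ j ⊎ suc j ≡ i ⊎ (i ≡ 0 × suc j ≡ n) ⊎ (j ≡ 0 × suc i ≡ n)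

Adjacent-sym : ∀ {n i j} → Adjacent n i j → Adjacent n j i
Adjacent-sym (inj₁ e)               = inj₂ (inj₁ e)
Adjacent-sym (inj₂ (inj₁ e))        = inj₁ e
Adjacent-sym (inj₂ (inj₂ (inj₁ e))) = inj₂ (inj₂ (inj₂ e))
Adjacent-sym (inj₂ (inj₂ (inj₂ e))) = inj₂ (inj₂ (inj₁ e))

¬Adjacent : ∀ {n i j} → 2 + i ≤ j → ¬ (i ≡ 0 × suc j ≡ n) → ¬ Adjacent n i j
¬Adjacent 2+i≤j _ (inj₁ refl)                    = 1+n≰n 2+i≤j
¬Adjacent 2+i≤j _ (inj₂ (inj₁ refl))             = 1+n≰n (≤-trans (n≤1+n _) (≤-trans (n≤1+n _) 2+i≤j))
¬Adjacent _ ¬wrap (inj₂ (inj₂ (inj₁ wrap)))      = ¬wrap wrap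
¬Adjacent () _ (inj₂ (inj₂ (inj₂ (refl , _))))

module _ {n : ℕ} where

  arc : ∀ {D} (x y : Fin n) → toℕ x ≤ toℕ y →
        (∀ j → toℕ x ≤ toℕ j → toℕ j ≤ toℕ y → j ∉ D) → Conn (Cycle n) D x y
  arc {D} x y x≤y free = walk (toℕ y ∸ toℕ x) x (m+[n∸m]≡n x≤y) free
    where
    walk : ∀ d u → toℕ u + d ≡ toℕ y →
           (∀ j → toℕ u ≤ toℕ j → toℕ j ≤ toℕ y → j ∉ D) → Conn (Cycle n) D u y
    walk zero u u≡y free′ with toℕ-injective (trans (sym (+-identityʳ (toℕ u))) u≡y)
    ... | refl = here (free′ u ≤-refl ≤-refl)
    walk (suc d) u u+d≡y free′ =
      step (free′ u ≤-refl (≤-trans (m≤m+n _ _) (≤-reflexive u+d≡y))) (inj₁ (sym toℕ-u⁺))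
           (walk d u⁺ (trans (cong (_+ d) toℕ-u⁺) (trans (sym (+-suc _ d)) u+d≡y))
                 (λ j u⁺≤j → free′ j (≤-trans (n≤1+n _) (subst (_≤ toℕ j) toℕ-u⁺ u⁺≤j))))
      where
      u⁺<n : suc (toℕ u) < n
      u⁺<n = <-≤-trans (s≤s (≤-trans (m≤m+n _ d) (≤-reflexive (trans (sym (+-suc _ d)) u+d≡y)))) (toℕ<n y)
      u⁺ : Fin n
      u⁺ = fromℕ< u⁺<n
      toℕ-u⁺ : toℕ u⁺ ≡ suc (toℕ u)
      toℕ-u⁺ = toℕ-fromℕ< u⁺<n

toℕ-≢⇒∉⁅⁆ : ∀ {n} {u v : Fin n} → toℕ u ≢ toℕ v → u ∉ ⁅ v ⁆
toℕ-≢⇒∉⁅⁆ ne = x≢y⇒x∉⁅y⁆ (ne ∘ cong toℕ)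

module _ {k : ℕ} where

  private
    n : ℕ
    n = 4 + k
    last : Fin n
    last = fromℕ (3 + k)
    toℕ-last : toℕ last ≡ 3 + k
    toℕ-last = toℕ-fromℕ (3 + k)

  Detour-first : Detour (Cycle n) zero
  Detour-first = record
    { x≢y    = λ eq → m≢1+m+n 1 (trans (cong toℕ eq) toℕ-last)
    ; x≁y    = ¬Adjacent (subst (3 ≤_) (sym toℕ-last) (s≤s (s≤s (s≤s z≤n)))) (λ ())
    ; x∼v    = inj₂ (inj₁ refl)
    ; v∼y    = inj₂ (inj₂ (inj₁ (refl , cong suc toℕ-last)))
    ; bypass = arc (suc zero) last (subst (1 ≤_) (sym toℕ-last) (s≤s z≤n))
                   (λ j 1≤j _ → toℕ-≢⇒∉⁅⁆ (λ j≡0 → 1+n≰n (subst (1 ≤_) j≡0 1≤j)))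
    }

  Detour-last : ∀ {v : Fin n} → toℕ v ≡ 3 + k → Detour (Cycle n) v
  Detour-last {v} v≡3+k = record
    { x = zero
    ; y = penultimate
    ; x≢y    = λ eq → 0≢1+n (trans (cong toℕ eq) toℕ-penultimate)
    ; x≁y    = ¬Adjacent (subst (2 ≤_) (sym toℕ-penultimate) (s≤s (s≤s z≤n)))
                         (λ (_ , wrap) → 1+n≢n (sym (trans (cong suc (sym toℕ-penultimate)) wrap)))
    ; x∼v    = inj₂ (inj₂ (inj₁ (refl , cong suc v≡3+k)))
    ; v∼y    = inj₂ (inj₁ (trans (cong suc toℕ-penultimate) (sym v≡3+k)))
    ; bypass = arc zero penultimate z≤n
                   (λ j _ j≤2+k → toℕ-≢⇒∉⁅⁆ (λ j≡v → 1+n≰n (subst (_≤ 2 + k) (trans j≡v v≡3+k)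
                                                              (subst (toℕ j ≤_) toℕ-penultimate j≤2+k))))
    }
    where
    penultimate : Fin n
    penultimate = inject₁ (fromℕ (2 + k))
    toℕ-penultimate : toℕ penultimate ≡ 2 + k
    toℕ-penultimate = trans (toℕ-inject₁ _) (toℕ-fromℕ _)

  Detour-inner : ∀ (v : Fin (3 + k)) → suc (toℕ v) < 3 + k → Detour (Cycle n) (suc v)
  Detour-inner v v+1<3+k = record
    { x = next
    ; y = previous
    ; x≢y    = <⇒≢ previous<next ∘ sym ∘ cong toℕ
    ; x≁y    = ¬Adjacent gap ¬wrap ∘ Adjacent-sym
    ; x∼v    = inj₂ (inj₁ (sym toℕ-next))
    ; v∼y    = inj₂ (inj₁ (cong suc toℕ-previous))
    ; bypass = Conn-++ (arc next last next≤last (λ j next≤j _ → avoids (>⇒≢ (≤-trans (≤-reflexive (sym toℕ-next)) next≤j))))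
                 (step (avoids (>⇒≢ (subst (suc (toℕ v) <_) (sym toℕ-last) v+1<3+k)))
                       (inj₂ (inj₂ (inj₂ (refl , cong suc toℕ-last))))
                       (arc zero previous z≤n (λ j _ j≤previous → avoids (<⇒≢ (s≤s (subst (toℕ j ≤_) toℕ-previous j≤previous))))))
    }
    where
    next : Fin n
    next = fromℕ< (s≤s v+1<3+k)
    toℕ-next : toℕ next ≡ 2 + toℕ v
    toℕ-next = toℕ-fromℕ< (s≤s v+1<3+k)
    previous : Fin n
    previous = inject₁ v
    toℕ-previous : toℕ previous ≡ toℕ v
    toℕ-previous = toℕ-inject₁ v
    gap : 2 + toℕ previous ≤ toℕ next
    gap = ≤-reflexive (trans (cong (2 +_) toℕ-previous) (sym toℕ-next))
    previous<next : toℕ previous < toℕ next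
    previous<next = ≤-trans (n≤1+n _) gap
    ¬wrap : ¬ (toℕ previous ≡ 0 × suc (toℕ next) ≡ n)
    ¬wrap (previous≡0 , wrap) = m≢1+m+n 3
      (trans (cong (3 +_) (trans (sym previous≡0) toℕ-previous)) (trans (cong suc (sym toℕ-next)) wrap))
    next≤last : toℕ next ≤ toℕ last
    next≤last = subst (toℕ next ≤_) (sym toℕ-last) (s≤s⁻¹ (toℕ<n next))
    avoids : ∀ {j} → toℕ j ≢ suc (toℕ v) → j ∉ ⁅ suc v ⁆
    avoids = toℕ-≢⇒∉⁅⁆

cycle-detour : ∀ {n} → 4 ≤ n → (v : Fin n) → Detour (Cycle n) v
cycle-detour (s≤s (s≤s (s≤s (s≤s _)))) zero = Detour-first
cycle-detour {suc (suc (suc (suc k)))} (s≤s (s≤s (s≤s (s≤s _)))) (suc v) with suc (toℕ v) <? 3 + k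
... | yes inner = Detour-inner v inner
... | no ¬inner = Detour-last (≤-antisym (toℕ<n v) (≮⇒≥ ¬inner))

cycle-mvd≤⌊n/2⌋ : ∀ {n k} → 4 ≤ n → (c : Fin n → Fin k) → UsesAll c → IsMVDColoring (Cycle n) c →
                 k ≤ ⌊ n /2⌋
cycle-mvd≤⌊n/2⌋ 4≤n c surj mvd =
  2k≤n⇒k≤⌊n/2⌋ (partners⇒2k≤n c surj (λ v → Detour⇒partner mvd (cycle-detour 4≤n v)))

between-closed : ∀ {n lo hi i j} → hi < n → j ≢ lo → j ≢ hi → Adjacent n i j →
                 lo < i × i < hi → lo < j × j < hi
between-closed _ _ j≢hi (inj₁ refl) (lo<i , i<hi) = <-trans lo<i (n<1+n _) , ≤∧≢⇒< i<hi j≢hi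
between-closed _ j≢lo _ (inj₂ (inj₁ refl)) (lo<i , i<hi) =
  ≤∧≢⇒< (s≤s⁻¹ lo<i) (j≢lo ∘ sym) , <-trans (n<1+n _) i<hi
between-closed _ _ _ (inj₂ (inj₂ (inj₁ (refl , _)))) (() , _)
between-closed hi<n _ _ (inj₂ (inj₂ (inj₂ (_ , refl)))) (_ , i<hi) = ⊥-elim (<⇒≱ i<hi (s≤s⁻¹ hi<n))

module _ {n : ℕ} where

  ∈⁅⁆∪⁅⁆⁻ : ∀ {u w j : Fin n} → j ∈ ⁅ u ⁆ ∪ ⁅ w ⁆ → j ≡ u ⊎ j ≡ w
  ∈⁅⁆∪⁅⁆⁻ {u} {w} j∈ with x∈p∪q⁻ ⁅ u ⁆ ⁅ w ⁆ j∈
  ... | inj₁ j∈⁅u⁆ = inj₁ (x∈⁅y⁆⇒x≡y u j∈⁅u⁆)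
  ... | inj₂ j∈⁅w⁆ = inj₂ (x∈⁅y⁆⇒x≡y w j∈⁅w⁆)

  ⁅⁆∪⁅⁆-monochromatic : ∀ {k} {c : Fin n → Fin k} {u w} → c u ≡ c w → Monochromatic c (⁅ u ⁆ ∪ ⁅ w ⁆)
  ⁅⁆∪⁅⁆-monochromatic cu≡cw a b a∈ b∈ with ∈⁅⁆∪⁅⁆⁻ a∈ | ∈⁅⁆∪⁅⁆⁻ b∈
  ... | inj₁ refl | inj₁ refl = refl
  ... | inj₁ refl | inj₂ refl = cu≡cw
  ... | inj₂ refl | inj₁ refl = sym cu≡cw
  ... | inj₂ refl | inj₂ refl = refl

  Between : Fin n → Fin n → Fin n → Set
  Between u w j = toℕ u < toℕ j × toℕ j < toℕ w

  ⁅⁆∪⁅⁆-cut : ∀ {u w x y : Fin n} → Between u w x → toℕ y < toℕ u ⊎ toℕ w < toℕ y →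
              VertexCut (Cycle n) x y (⁅ u ⁆ ∪ ⁅ w ⁆)
  ⁅⁆∪⁅⁆-cut {u} {w} {x} {y} (u<x , x<w) y-outside = x∉D , y∉D y-outside , ¬walk y-outside
    where
    x∉D : x ∉ ⁅ u ⁆ ∪ ⁅ w ⁆
    x∉D x∈ with ∈⁅⁆∪⁅⁆⁻ x∈
    ... | inj₁ refl = <-irrefl refl u<x
    ... | inj₂ refl = <-irrefl refl x<w
    y∉D : toℕ y < toℕ u ⊎ toℕ w < toℕ y → y ∉ ⁅ u ⁆ ∪ ⁅ w ⁆
    y∉D y-outside y∈ with ∈⁅⁆∪⁅⁆⁻ y∈ | y-outside
    ... | inj₁ refl | inj₁ y<u = <-irrefl refl y<u
    ... | inj₁ refl | inj₂ w<y = <-asym w<y (<-trans u<x x<w)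
    ... | inj₂ refl | inj₁ y<u = <-asym y<u (<-trans u<x x<w)
    ... | inj₂ refl | inj₂ w<y = <-irrefl refl w<y
    closed : ∀ {i j} → j ∉ ⁅ u ⁆ ∪ ⁅ w ⁆ → Cycle n i j → Between u w i → Between u w j
    closed {j = j} j∉D = between-closed (toℕ<n w)
      (λ j≡u → j∉D (x∈p∪q⁺ (inj₁ (subst (_∈ ⁅ u ⁆) (sym (toℕ-injective j≡u)) (x∈⁅x⁆ u)))))
      (λ j≡w → j∉D (x∈p∪q⁺ (inj₂ (subst (_∈ ⁅ w ⁆) (sym (toℕ-injective j≡w)) (x∈⁅x⁆ w)))))
    ¬walk : toℕ y < toℕ u ⊎ toℕ w < toℕ y → ¬ Conn (Cycle n) (⁅ u ⁆ ∪ ⁅ w ⁆) x y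
    ¬walk y-outside walk with Conn-preserves (Between u w) closed walk (u<x , x<w) | y-outside
    ... | (u<y , _) | inj₁ y<u = <-asym u<y y<u
    ... | (_ , y<w) | inj₂ w<y = <-asym y<w w<y

record CutPair (m n a b : ℕ) : Set where
  field
    {p q}     : ℕ
    a<p       : a < p
    p<b       : p < b
    q<n       : q < n
    q-outside : q < a ⊎ b < q
    offset    : p ≡ q + m ⊎ q ≡ p + m

2+i≤i+m : ∀ {m} i → 2 ≤ m → 2 + i ≤ i + m
2+i≤i+m {m} i 2≤m = subst (_≤ i + m) (+-comm i 2) (+-monoʳ-≤ i 2≤m)

i+m≡1+j⇒i<j : ∀ {m i j} → 2 ≤ m → i + m ≡ suc j → i < j
i+m≡1+j⇒i<j {i = i} 2≤m eq = s≤s⁻¹ (subst (2 + i ≤_) eq (2+i≤i+m i 2≤m))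

-- When b − a > m and a = 0, non-adjacency of 0 and b gives b + 1 < n, room for q = b + 1.
cutPair : ∀ {m n a b} → 2 ≤ m → m + m ≤ n → a < b → b < n → suc a ≢ b → ¬ (a ≡ 0 × suc b ≡ n) →
          CutPair m n a b
cutPair {m} {n} {a} {b} 2≤m 2m≤n a<b b<n a+1≢b ¬wrap with m ≤? suc a
... | yes m≤a+1 = record
  { a<p = ≤-refl ; p<b = ≤∧≢⇒< a<b a+1≢b ; q<n = <-trans q<a (<-trans a<b b<n)
  ; q-outside = inj₁ q<a ; offset = inj₁ (sym (m∸n+n≡m m≤a+1)) }
  where
  q<a : suc a ∸ m < a
  q<a = i+m≡1+j⇒i<j 2≤m (m∸n+n≡m m≤a+1)
... | no m≰a+1 with b <? suc a + m
...   | yes b<a+1+m = record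
  { a<p = ≤-refl ; p<b = ≤∧≢⇒< a<b a+1≢b ; q<n = <-≤-trans (+-monoˡ-< m (≰⇒> m≰a+1)) 2m≤n
  ; q-outside = inj₂ b<a+1+m ; offset = inj₂ refl }
...   | no b≮a+1+m with a
...     | suc a′ = record
  { a<p = 2+i≤i+m a′ 2≤m ; p<b = <-≤-trans (+-monoˡ-< m (≤-trans (n<1+n a′) (n≤1+n _))) (≮⇒≥ b≮a+1+m)
  ; q<n = <-trans (n<1+n a′) (<-trans a<b b<n) ; q-outside = inj₁ (n<1+n a′) ; offset = inj₁ refl }
...     | zero = record
  { a<p = m<n⇒0<n∸m (s≤s m≤b) ; p<b = i+m≡1+j⇒i<j 2≤m (m∸n+n≡m (m≤n⇒m≤1+n m≤b))
  ; q<n = ≤∧≢⇒< b<n (λ b+1≡n → ¬wrap (refl , b+1≡n)) ; q-outside = inj₂ (n<1+n b)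
  ; offset = inj₂ (sym (m∸n+n≡m (m≤n⇒m≤1+n m≤b))) }
  where
  m≤b : m ≤ b
  m≤b = ≤-trans (n≤1+n m) (≮⇒≥ b≮a+1+m)

module _ {n m : ℕ} .{{_ : NonZero m}} (2≤m : 2 ≤ m) (2m≤n : m + m ≤ n) where

  residue : Fin n → Fin m
  residue v = fromℕ< (m%n<n (toℕ v) m)

  residue-surjective : UsesAll residue
  residue-surjective a = inject≤ a m≤n , toℕ-injective (begin
    toℕ (residue (inject≤ a m≤n)) ≡⟨ toℕ-fromℕ< _ ⟩
    toℕ (inject≤ a m≤n) % m       ≡⟨ cong (_% m) (toℕ-inject≤ a m≤n) ⟩
    toℕ a % m                     ≡⟨ m<n⇒m%n≡m (toℕ<n a) ⟩
    toℕ a                         ∎)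
    where
    open ≡-Reasoning
    m≤n : m ≤ n
    m≤n = ≤-trans (m≤m+n m m) 2m≤n

  residue-+m : ∀ {u w : Fin n} → toℕ u ≡ toℕ w + m → residue u ≡ residue w
  residue-+m eq = fromℕ<-cong _ _ (trans (cong (_% m) eq) ([m+n]%n≡m%n _ m)) _ _

  residue-cut< : ∀ {x y} → toℕ x < toℕ y → ¬ Cycle n x y →
                 ∃ λ D → VertexCut (Cycle n) x y D × Monochromatic residue D
  residue-cut< {x} {y} x<y x≁y = cut q-outside
    where
    open CutPair (cutPair 2≤m 2m≤n x<y (toℕ<n y) (x≁y ∘ inj₁) (x≁y ∘ inj₂ ∘ inj₂ ∘ inj₁))
    u w : Fin n
    u = fromℕ< (<-trans p<b (toℕ<n y))
    w = fromℕ< q<n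
    toℕ-u : toℕ u ≡ p
    toℕ-u = toℕ-fromℕ< _
    toℕ-w : toℕ w ≡ q
    toℕ-w = toℕ-fromℕ< _
    same-residue : residue u ≡ residue w
    same-residue with offset
    ... | inj₁ p≡q+m = residue-+m (trans toℕ-u (trans p≡q+m (cong (_+ m) (sym toℕ-w))))
    ... | inj₂ q≡p+m = sym (residue-+m (trans toℕ-w (trans q≡p+m (cong (_+ m) (sym toℕ-u)))))
    cut : q < toℕ x ⊎ toℕ y < q → ∃ λ D → VertexCut (Cycle n) x y D × Monochromatic residue D
    cut (inj₁ q<x) = ⁅ w ⁆ ∪ ⁅ u ⁆
      , ⁅⁆∪⁅⁆-cut (subst (_< toℕ x) (sym toℕ-w) q<x , subst (toℕ x <_) (sym toℕ-u) a<p)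
                  (inj₂ (subst (_< toℕ y) (sym toℕ-u) p<b))
      , ⁅⁆∪⁅⁆-monochromatic (sym same-residue)
    cut (inj₂ y<q) = ⁅ u ⁆ ∪ ⁅ w ⁆
      , VertexCut-sym Adjacent-sym
          (⁅⁆∪⁅⁆-cut (subst (_< toℕ y) (sym toℕ-u) p<b , subst (toℕ y <_) (sym toℕ-w) y<q)
                     (inj₁ (subst (toℕ x <_) (sym toℕ-u) a<p)))
      , ⁅⁆∪⁅⁆-monochromatic same-residue

  residue-mvd : IsMVDColoring (Cycle n) residue
  residue-mvd x y x≢y x≁y with <-cmp (toℕ x) (toℕ y)
  ... | tri< x<y _ _ = residue-cut< x<y x≁y
  ... | tri≈ _ x≡y _ = ⊥-elim (x≢y (toℕ-injective x≡y))
  ... | tri> _ _ y<x with residue-cut< y<x (x≁y ∘ Adjacent-sym)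
  ...   | D , cut , monochromatic = D , VertexCut-sym Adjacent-sym cut , monochromatic

lemma3p1 : ∀ (n : ℕ) → 4 ≤ n → MVD≡ (Cycle n) ⌊ n /2⌋
lemma3p1 n 4≤n@(s≤s (s≤s (s≤s (s≤s _)))) =
  (residue 2≤m 2m≤n , residue-surjective 2≤m 2m≤n , residue-mvd 2≤m 2m≤n) ,
  λ _ c surj mvd → cycle-mvd≤⌊n/2⌋ 4≤n c surj mvd
  where
  2≤m : 2 ≤ ⌊ n /2⌋
  2≤m = ⌊n/2⌋-mono 4≤n
  2m≤n : ⌊ n /2⌋ + ⌊ n /2⌋ ≤ n
  2m≤n = subst (⌊ n /2⌋ + ⌊ n /2⌋ ≤_) (⌊n/2⌋+⌈n/2⌉≡n n) (+-monoʳ-≤ ⌊ n /2⌋ (⌊n/2⌋≤⌈n/2⌉ n))
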